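{- For any simple graph $G$ and any edge $e\in E(G)$, $$\tau(G,x)=\tau(G\backslash e,x)+\tau(G/e,x).$$
   Context: $G\backslash e$ is obtained from $G$ by deleting $e$; $G/e$ by contracting $e$ and removing parallel edges but one. For a simple graph $H$ of order $n$ with chromatic polynomial $\chi(H,x)$, the $c_i(H)$ are defined by $\chi(H,x)=\sum_{0\le i\le n}(-1)^{n-i}c_i(H)\langle x\rangle_i$, with $\langle x\rangle_i=x(x+1)\cdots(x+i-1)$, and $\tau(H,x)=\sum_i c_i(H)x^i$. -}

module Defs where

open import Data.Bool using (Bool; true; false; _∧_; _∨_; not; if_then_else_)
open import Data.Nat as ℕ using (ℕ; zero; suc; _<_; _∸_)
open import Data.Fin using (Fin; punchIn)
open import Data.Fin.Properties using (_≟_)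
open import Data.List using (List; []; _∷_; map; concatMap; filter; length; allFin; upTo; foldr)
open import Data.Bool.ListAction using (all)
open import Data.Integer as ℤ using (ℤ; +_; -_)
open import Data.Product using (_×_)
open import Relation.Nullary.Decidable using (⌊_⌋)
open import Relation.Binary.PropositionalEquality using (_≡_)

_==_ : ∀ {n} → Fin n → Fin n → Bool
a == b = ⌊ a ≟ b ⌋

-- It is given by a Boolean
-- "edge indicator" E; two vertices a, b are adjacent iff a ≠ b and
-- (E a b or E b a).  Hence adjacency is automatically symmetric and
-- loopless, and every simple graph on Fin n arises this way.
record Graph (n : ℕ) : Set where
  constructor graph
  field
    E : Fin n → Fin n → Bool

open Graph public

Adj : ∀ {n} → Graph n → Fin n → Fin n → Bool
Adj G a b = not (a == b) ∧ (E G a b ∨ E G b a)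

delete : ∀ {n} → Graph n → Fin n → Fin n → Graph n
delete G u v = graph λ a b →
  Adj G a b ∧ not ((a == u ∧ b == v) ∨ (a == v ∧ b == u))

-- G / e  for e = {u,v}: vertex v is merged into u.  The vertices of G/e
-- are Fin m, identified with the vertices of G other than v via punchIn v.
-- Loops are removed (Adj is loopless) and parallel edges are identified
-- automatically (adjacency is a relation).
contract : ∀ {m} → Graph (suc m) → Fin (suc m) → Fin (suc m) → Graph m
contract G u v = graph λ a b →
  let a' = punchIn v a ; b' = punchIn v b in
  Adj G a' b' ∨ (a' == u ∧ Adj G v b') ∨ (b' == u ∧ Adj G a' v)

allColourings : (n x : ℕ) → List (Fin n → Fin x)
allColourings zero    x = (λ ()) ∷ []
allColourings (suc n) x =
  concatMap (λ c → map (λ f → λ { Fin.zero → c ; (Fin.suc i) → f i })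
                       (allColourings n x))
            (allFin x)

proper : ∀ {n x} → Graph n → (Fin n → Fin x) → Bool
proper {n} G f = all (λ a → all (λ b → not (Adj G a b ∧ (f a == f b))) (allFin n)) (allFin n)

chrom : ∀ {n} → Graph n → ℕ → ℕ
chrom {n} G x = length (filter (λ f → proper G f Data.Bool.≟ true) (allColourings n x))

rising : ℕ → ℕ → ℕ
rising x zero    = 1
rising x (suc i) = rising x i ℕ.* (x ℕ.+ i)

sgn : ℕ → ℤ
sgn zero    = + 1
sgn (suc k) = - sgn k

risingSum : (n : ℕ) → (ℕ → ℤ) → ℕ → ℤ
risingSum n c x =
  foldr ℤ._+_ (+ 0) (map (λ i → sgn (n ∸ i) ℤ.* c i ℤ.* (+ rising x i)) (upTo (suc n)))

-- c is the coefficient sequence (c_i(H))_i of H: c_i = 0 for i > n and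
-- χ(H,x) = Σ_{0≤i≤n} (-1)^{n-i} c_i ⟨x⟩_i  (as polynomials, i.e. for all x ∈ ℕ).
-- τ(H,x) = Σ_i c_i x^i is then the polynomial with coefficient sequence c.
IsCoeffs : ∀ {n} → Graph n → (ℕ → ℤ) → Set
IsCoeffs {n} H c = (∀ i → n < i → c i ≡ + 0) × (∀ x → + chrom H x ≡ risingSum n c x)

module Submission where

-- Proper colourings f of G\e split into those with f u ≠ f v, which are exactly the proper
-- colourings of G, and those with f u = f v, which correspond (forget the colour of v) to the
-- proper colourings of G/e.  Hence χ(G) = χ(G\e) − χ(G/e), and since G/e has one vertex fewer,
-- −χ(G/e,x) = Σ_i (−1)^{n−i} c_i(G/e) ⟨x⟩_i with n = |V(G)|.  So χ(G) has two expansions in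
-- rising factorials, with coefficients c_i(G) and c_i(G\e) + c_i(G/e); they agree because rising
-- factorials are linearly independent as functions on ℕ.

module DeletionContraction where

  open import Defs
  open import Data.Bool using (Bool; true; false; T; _∧_; _∨_; not)
  open import Data.Bool.Properties using (T-∧; T-∨; ∧-comm; ∨-comm; ∨-idem; ∧-zeroʳ)
  open import Data.Bool.ListAction using (all)
  open import Data.Empty using (⊥-elim)
  open import Data.Nat using (ℕ; zero; suc; _+_)
  open import Data.Nat.Properties using (+-assoc; +-commutativeSemigroup)
  open import Algebra.Properties.CommutativeSemigroup +-commutativeSemigroup using (interchange)
  open import Data.Fin using (Fin; punchIn; punchOut)
  open import Data.Fin.Properties using (_≟_; suc-injective; punchInᵢ≢i; punchIn-injective; punchIn-punchOut)
  open import Data.List using (List; []; _∷_; _++_; map; concatMap; filter; length; allFin; tabulate)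
  open import Data.List.Relation.Unary.All as All using ()
  open import Data.List.Relation.Unary.All.Properties using (all⁺; all⁻)
  open import Data.List.Membership.Propositional.Properties using (∈-allFin)
  open import Data.Vec.Functional using (insertAt)
  open import Data.Vec.Functional.Properties using (insertAt-lookup; insertAt-punchIn)
  open import Data.Product using (_×_; _,_; proj₁; proj₂)
  open import Data.Sum using (_⊎_; inj₁; inj₂)
  open import Function using (_∘_; _⇔_; mk⇔; Equivalence)
  open import Function.Construct.Composition using (_⇔-∘_)
  open import Function.Construct.Identity using (⇔-id)
  open import Data.Product.Function.NonDependent.Propositional using (_×-⇔_)
  open import Data.Sum.Function.Propositional using (_⊎-⇔_)
  open import Function.Related.TypeIsomorphisms using (¬-cong-⇔)
  open import Relation.Nullary using (¬_; yes; no)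
  open import Relation.Nullary.Decidable using (_×-dec_; _⊎-dec_; toWitness; fromWitness; ⌊⌋-map′)
  open import Relation.Binary.PropositionalEquality

  open Equivalence using (to; from)
  open ≡-Reasoning

  T-not : ∀ {p} → T (not p) ⇔ (¬ T p)
  T-not {true}  = mk⇔ (λ ()) (λ ¬t → ¬t _)
  T-not {false} = mk⇔ (λ _ ()) (λ _ → _)

  T-cong : ∀ {p q} → p ≡ q → T p ⇔ T q
  T-cong refl = ⇔-id _

  T-⇔⇒≡ : ∀ {p q} → T p ⇔ T q → p ≡ q
  T-⇔⇒≡ {true}  {true}  _   = refl
  T-⇔⇒≡ {true}  {false} p⇔q = ⊥-elim (to p⇔q _)
  T-⇔⇒≡ {false} {true}  p⇔q = ⊥-elim (from p⇔q _)
  T-⇔⇒≡ {false} {false} _   = refl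

  T-all-allFin : ∀ {n} (p : Fin n → Bool) → T (all p (allFin n)) ⇔ (∀ i → T (p i))
  T-all-allFin p = mk⇔ (λ t i → All.lookup (all⁺ p _ t) (∈-allFin i))
                       (λ h → all⁻ p {allFin _} (All.tabulate (λ {i} _ → h i)))

  module _ {n : ℕ} where

    T-== : {a b : Fin n} → T (a == b) ⇔ a ≡ b
    T-== = mk⇔ toWitness fromWitness

    ==-sym : (a b : Fin n) → (a == b) ≡ (b == a)
    ==-sym a b = T-⇔⇒≡ (mk⇔ (from T-== ∘ sym ∘ to T-==) (from T-== ∘ sym ∘ to T-==))

  ==-suc : ∀ {n} (a c : Fin n) → (Fin.suc a == Fin.suc c) ≡ (a == c)
  ==-suc a c = ⌊⌋-map′ (cong Fin.suc) suc-injective (a ≟ c)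

  ∧-absorbˡ : ∀ p q r → p ∧ ((p ∧ q) ∧ r) ≡ (p ∧ q) ∧ r
  ∧-absorbˡ true  q r = refl
  ∧-absorbˡ false q r = refl

  𝟙 : Bool → ℕ
  𝟙 true  = 1
  𝟙 false = 0

  𝟙-split : ∀ p q → 𝟙 p ≡ 𝟙 (p ∧ not q) + 𝟙 (p ∧ q)
  𝟙-split true  true  = refl
  𝟙-split true  false = refl
  𝟙-split false q     = refl

  sumOver : {A : Set} → List A → (A → ℕ) → ℕ
  sumOver []       w = 0
  sumOver (a ∷ as) w = w a + sumOver as w

  module _ {A : Set} where

    sumOver-cong : ∀ (xs : List A) {w w′ : A → ℕ} → (∀ a → w a ≡ w′ a) → sumOver xs w ≡ sumOver xs w′
    sumOver-cong []       eq = refl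
    sumOver-cong (a ∷ xs) eq = cong₂ _+_ (eq a) (sumOver-cong xs eq)

    sumOver-zero : ∀ (xs : List A) → sumOver xs (λ _ → 0) ≡ 0
    sumOver-zero []       = refl
    sumOver-zero (a ∷ xs) = sumOver-zero xs

    sumOver-+ : ∀ (xs : List A) (w w′ : A → ℕ) →
                sumOver xs (λ a → w a + w′ a) ≡ sumOver xs w + sumOver xs w′
    sumOver-+ []       w w′ = refl
    sumOver-+ (a ∷ xs) w w′ rewrite sumOver-+ xs w w′ = interchange (w a) (w′ a) _ _

    sumOver-++ : ∀ (xs ys : List A) (w : A → ℕ) → sumOver (xs ++ ys) w ≡ sumOver xs w + sumOver ys w
    sumOver-++ []       ys w = refl
    sumOver-++ (a ∷ xs) ys w rewrite sumOver-++ xs ys w = sym (+-assoc (w a) _ _)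

  module _ {A B : Set} where

    sumOver-map : ∀ (k : A → B) (xs : List A) (w : B → ℕ) → sumOver (map k xs) w ≡ sumOver xs (w ∘ k)
    sumOver-map k []       w = refl
    sumOver-map k (a ∷ xs) w = cong (w (k a) +_) (sumOver-map k xs w)

    sumOver-concatMap : ∀ (k : A → List B) (xs : List A) (w : B → ℕ) →
                        sumOver (concatMap k xs) w ≡ sumOver xs (λ a → sumOver (k a) w)
    sumOver-concatMap k []       w = refl
    sumOver-concatMap k (a ∷ xs) w =
      trans (sumOver-++ (k a) (concatMap k xs) w) (cong (sumOver (k a) w +_) (sumOver-concatMap k xs w))

    sumOver-comm : ∀ (xs : List A) (ys : List B) (w : A → B → ℕ) →
                   sumOver xs (λ a → sumOver ys (w a)) ≡ sumOver ys (λ b → sumOver xs (λ a → w a b))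
    sumOver-comm []       ys w = sym (sumOver-zero ys)
    sumOver-comm (a ∷ xs) ys w =
      trans (cong (sumOver ys (w a) +_) (sumOver-comm xs ys w))
            (sym (sumOver-+ ys (w a) (λ b → sumOver xs (λ a′ → w a′ b))))

  sumOver-tabulate : ∀ {A : Set} {n} (f : Fin n → A) (w : A → ℕ) →
                     sumOver (tabulate f) w ≡ sumOver (allFin n) (w ∘ f)
  sumOver-tabulate {n = zero}  f w = refl
  sumOver-tabulate {n = suc n} f w =
    cong (w (f Fin.zero) +_)
         (trans (sumOver-tabulate (f ∘ Fin.suc) w) (sym (sumOver-tabulate Fin.suc (w ∘ f))))

  length-filter≡sumOver : ∀ {A : Set} (p : A → Bool) (xs : List A) →
                          length (filter (λ a → p a Data.Bool.≟ true) xs) ≡ sumOver xs (𝟙 ∘ p)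
  length-filter≡sumOver p []       = refl
  length-filter≡sumOver p (a ∷ xs) with p a
  ... | true  = cong suc (length-filter≡sumOver p xs)
  ... | false = length-filter≡sumOver p xs

  sumOver-allFin-𝟙-== : ∀ {n} (a : Fin n) → sumOver (allFin n) (λ c → 𝟙 (a == c)) ≡ 1
  sumOver-allFin-𝟙-== {suc n} Fin.zero =
    cong suc (trans (sumOver-tabulate {n = n} Fin.suc (λ c → 𝟙 (Fin.zero == c))) (sumOver-zero (allFin n)))
  sumOver-allFin-𝟙-== {suc n} (Fin.suc a) = begin
    sumOver (tabulate Fin.suc) (λ c → 𝟙 (Fin.suc a == c)) ≡⟨ sumOver-tabulate {n = n} Fin.suc _ ⟩
    sumOver (allFin n) (λ c → 𝟙 (Fin.suc a == Fin.suc c)) ≡⟨ sumOver-cong (allFin n) (cong 𝟙 ∘ ==-suc a) ⟩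
    sumOver (allFin n) (λ c → 𝟙 (a == c))                 ≡⟨ sumOver-allFin-𝟙-== a ⟩
    1                                                     ∎

  sumOver-allFin-𝟙-∧-== : ∀ {x} p (a : Fin x) → sumOver (allFin x) (λ c → 𝟙 (p ∧ (a == c))) ≡ 𝟙 p
  sumOver-allFin-𝟙-∧-== true  a = sumOver-allFin-𝟙-== a
  sumOver-allFin-𝟙-∧-== {x} false a = sumOver-zero (allFin x)

  insertAt-cong : ∀ {A : Set} {m} {f g : Fin m → A} (v : Fin (suc m)) (c : A) →
                  (∀ i → f i ≡ g i) → ∀ i → insertAt f v c i ≡ insertAt g v c i
  insertAt-cong             Fin.zero    c eq Fin.zero    = refl
  insertAt-cong             Fin.zero    c eq (Fin.suc i) = eq i
  insertAt-cong {m = suc m} (Fin.suc v) c eq Fin.zero    = eq Fin.zero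
  insertAt-cong {m = suc m} (Fin.suc v) c eq (Fin.suc i) = insertAt-cong v c (eq ∘ Fin.suc) i

  module _ (x : ℕ) where

    Colouring : ℕ → Set
    Colouring n = Fin n → Fin x

    Extensional : ∀ {n} → (Colouring n → ℕ) → Set
    Extensional w = ∀ {f g} → (∀ i → f i ≡ g i) → w f ≡ w g

    sumColourings : ∀ n → (Colouring n → ℕ) → ℕ
    sumColourings n = sumOver (allColourings n x)

    sumColourings-insertAt : ∀ m (v : Fin (suc m)) (w : Colouring (suc m) → ℕ) → Extensional w →
      sumColourings (suc m) w ≡ sumOver (allFin x) (λ c → sumColourings m (λ g → w (insertAt g v c)))
    sumColourings-insertAt m Fin.zero w ext =
      trans (sumOver-concatMap _ (allFin x) w)
            (sumOver-cong (allFin x) λ c →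
              trans (sumOver-map _ (allColourings m x) w)
                    (sumOver-cong (allColourings m x) λ g → ext λ { Fin.zero → refl ; (Fin.suc i) → refl }))
    sumColourings-insertAt (suc m) (Fin.suc v) w ext = begin
      sumColourings (suc (suc m)) w
        ≡⟨ sumColourings-insertAt (suc m) Fin.zero w ext ⟩
      sumOver (allFin x) (λ d → sumColourings (suc m) (λ g → w (insertAt g Fin.zero d)))
        ≡⟨ sumOver-cong (allFin x) (λ d → sumColourings-insertAt m v _ (ext ∘ insertAt-cong Fin.zero d)) ⟩
      sumOver (allFin x) (λ d → sumOver (allFin x) λ c →
        sumColourings m (λ h → w (insertAt (insertAt h v c) Fin.zero d)))
        ≡⟨ sumOver-comm (allFin x) (allFin x) _ ⟩
      sumOver (allFin x) (λ c → sumOver (allFin x) λ d →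
        sumColourings m (λ h → w (insertAt (insertAt h v c) Fin.zero d)))
        ≡⟨ sumOver-cong (allFin x) (λ c → sumOver-cong (allFin x) λ d →
             sumOver-cong (allColourings m x) λ h → ext λ { Fin.zero → refl ; (Fin.suc i) → refl }) ⟩
      sumOver (allFin x) (λ c → sumOver (allFin x) λ d →
        sumColourings m (λ h → w (insertAt (insertAt h Fin.zero d) (Fin.suc v) c)))
        ≡⟨ sumOver-cong (allFin x) (λ c →
             sym (sumColourings-insertAt m Fin.zero _ (ext ∘ insertAt-cong (Fin.suc v) c))) ⟩
      sumOver (allFin x) (λ c → sumColourings (suc m) (λ g → w (insertAt g (Fin.suc v) c)))
        ∎

  module _ {n : ℕ} (G : Graph n) where

    Adj-sym : ∀ a b → Adj G a b ≡ Adj G b a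
    Adj-sym a b = cong₂ _∧_ (cong not (==-sym a b)) (∨-comm (E G a b) (E G b a))

    Adj⇒≢ : ∀ {a b} → T (Adj G a b) → a ≢ b
    Adj⇒≢ adj a≡b = to T-not (proj₁ (to T-∧ adj)) (from T-== a≡b)

    Adj-of-symmetric : (∀ a b → E G a b ≡ E G b a) → ∀ a b → Adj G a b ≡ not (a == b) ∧ E G a b
    Adj-of-symmetric E-sym a b rewrite E-sym b a = cong (not (a == b) ∧_) (∨-idem (E G a b))

    Proper : ∀ {x} → (Fin n → Fin x) → Set
    Proper f = ∀ {a b} → T (Adj G a b) → f a ≢ f b

    T-proper : ∀ {x} (f : Fin n → Fin x) → T (proper G f) ⇔ Proper f
    T-proper f = mk⇔
      (λ t {a} {b} adj fa≡fb →
        to T-not (to (T-all-allFin (clash a)) (to (T-all-allFin row) t a) b) (from T-∧ (adj , from T-== fa≡fb)))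
      (λ prop → from (T-all-allFin row) λ a → from (T-all-allFin (clash a)) λ b →
        from T-not λ t → let adj , eq = to T-∧ t in prop adj (to T-== eq))
      where
      clash : Fin n → Fin n → Bool
      clash a b = not (Adj G a b ∧ (f a == f b))
      row : Fin n → Bool
      row a = all (clash a) (allFin n)

  proper-cong : ∀ {n x} (H : Graph n) {f g : Fin n → Fin x} → (∀ i → f i ≡ g i) →
                proper H f ≡ proper H g
  proper-cong H {f} {g} f≗g = T-⇔⇒≡ (mk⇔ (transport f≗g) (transport (sym ∘ f≗g)))
    where
    transport : ∀ {f g} → (∀ i → f i ≡ g i) → T (proper H f) → T (proper H g)
    transport {f} {g} f≗g t = from (T-proper H g) λ {a} {b} adj ga≡gb →
      to (T-proper H f) t adj (trans (f≗g a) (trans ga≡gb (sym (f≗g b))))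

  module _ {n : ℕ} where

    sameEdge : (u v a b : Fin n) → Bool
    sameEdge u v a b = (a == u ∧ b == v) ∨ (a == v ∧ b == u)

    SameEdge : (u v a b : Fin n) → Set
    SameEdge u v a b = (a ≡ u × b ≡ v) ⊎ (a ≡ v × b ≡ u)

    sameEdge-sym : ∀ u v a b → sameEdge u v a b ≡ sameEdge u v b a
    sameEdge-sym u v a b =
      trans (∨-comm (a == u ∧ b == v) _) (cong₂ _∨_ (∧-comm (a == v) _) (∧-comm (a == u) _))

    T-sameEdge : ∀ {u v a b} → T (sameEdge u v a b) ⇔ SameEdge u v a b
    T-sameEdge = ((T-== ×-⇔ T-==) ⇔-∘ T-∧ ⊎-⇔ (T-== ×-⇔ T-==) ⇔-∘ T-∧) ⇔-∘ T-∨

    module _ (G : Graph n) (u v : Fin n) where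

      Adj-delete : ∀ a b → Adj (delete G u v) a b ≡ Adj G a b ∧ not (sameEdge u v a b)
      Adj-delete a b = trans (Adj-of-symmetric (delete G u v) E-sym a b)
                             (∧-absorbˡ (not (a == b)) (E G a b ∨ E G b a) (not (sameEdge u v a b)))
        where
        E-sym : ∀ a b → E (delete G u v) a b ≡ E (delete G u v) b a
        E-sym a b = cong₂ _∧_ (Adj-sym G a b) (cong not (sameEdge-sym u v a b))

      T-Adj-delete : ∀ {a b} → T (Adj (delete G u v) a b) ⇔ (T (Adj G a b) × ¬ SameEdge u v a b)
      T-Adj-delete {a} {b} =
        (⇔-id _ ×-⇔ ¬-cong-⇔ T-sameEdge ⇔-∘ T-not) ⇔-∘ (T-∧ ⇔-∘ T-cong (Adj-delete a b))

  module _ {m : ℕ} (G : Graph (suc m)) (u v : Fin (suc m)) where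

    Linked : Fin m → Fin m → Set
    Linked a b = T (Adj G (punchIn v a) (punchIn v b))
               ⊎ (punchIn v a ≡ u × T (Adj G v (punchIn v b)))
               ⊎ (punchIn v b ≡ u × T (Adj G (punchIn v a) v))

    T-E-contract : ∀ {a b} → T (E (contract G u v) a b) ⇔ Linked a b
    T-E-contract =
      (⇔-id _ ⊎-⇔ ((T-== ×-⇔ ⇔-id _) ⇔-∘ T-∧ ⊎-⇔ (T-== ×-⇔ ⇔-id _) ⇔-∘ T-∧) ⇔-∘ T-∨) ⇔-∘ T-∨

    T-Adj-contract : ∀ {a b} → T (Adj (contract G u v) a b) ⇔ (a ≢ b × Linked a b)
    T-Adj-contract {a} {b} =
      (¬-cong-⇔ T-== ⇔-∘ T-not ×-⇔ T-E-contract) ⇔-∘ (T-∧ ⇔-∘ T-cong (Adj-of-symmetric C E-sym a b))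
      where
      C = contract G u v
      E-sym : ∀ a b → E C a b ≡ E C b a
      E-sym a b = cong₂ _∨_ (Adj-sym G a′ b′)
        (trans (∨-comm (a′ == u ∧ Adj G v b′) _)
               (cong₂ _∨_ (cong (b′ == u ∧_) (Adj-sym G a′ v)) (cong (a′ == u ∧_) (Adj-sym G v b′))))
        where a′ = punchIn v a
              b′ = punchIn v b

  data PunchInView {m : ℕ} (v : Fin (suc m)) : Fin (suc m) → Set where
    at       : PunchInView v v
    punchedIn : ∀ a → PunchInView v (punchIn v a)

  punchInView : ∀ {m} (v p : Fin (suc m)) → PunchInView v p
  punchInView v p with v ≟ p
  ... | yes refl = at
  ... | no v≢p   = subst (PunchInView v) (punchIn-punchOut v≢p) (punchedIn (punchOut v≢p))

  module _ {m : ℕ} (G : Graph (suc m)) {u v : Fin (suc m)} (uv : T (Adj G u v)) where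

    private
      D = delete G u v
      C = contract G u v

    proper-delete : ∀ {x} (f : Fin (suc m) → Fin x) → proper G f ≡ proper D f ∧ not (f u == f v)
    proper-delete f = T-⇔⇒≡ (mk⇔ fwd bwd)
      where
      fwd : T (proper G f) → T (proper D f ∧ not (f u == f v))
      fwd t = from T-∧ ( from (T-proper D f) (pG ∘ proj₁ ∘ to (T-Adj-delete G u v))
                       , from T-not (pG uv ∘ to T-==) )
        where pG = to (T-proper G f) t
      bwd : T (proper D f ∧ not (f u == f v)) → T (proper G f)
      bwd t = from (T-proper G f) separated
        where
        pD = to (T-proper D f) (proj₁ (to T-∧ t))
        fu≢fv : f u ≢ f v
        fu≢fv = to T-not (proj₂ (to T-∧ t)) ∘ from T-==
        separated : Proper G f
        separated {a} {b} adj with (a ≟ u ×-dec b ≟ v) ⊎-dec (a ≟ v ×-dec b ≟ u)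
        ... | yes (inj₁ (refl , refl)) = fu≢fv
        ... | yes (inj₂ (refl , refl)) = fu≢fv ∘ sym
        ... | no ¬uv                   = pD (from (T-Adj-delete G u v) (adj , ¬uv))

    module _ {x} {u′ : Fin m} (u′↦u : punchIn v u′ ≡ u) (g : Fin m → Fin x) where

      private
        f : Fin (suc m) → Fin x
        f = insertAt g v (g u′)

        f∘punchIn : ∀ a → f (punchIn v a) ≡ g a
        f∘punchIn = insertAt-punchIn g v (g u′)

        f-v : f v ≡ g u′
        f-v = insertAt-lookup g v (g u′)

        v≢u : v ≢ u
        v≢u = Adj⇒≢ G uv ∘ sym

      proper-contract : proper D f ≡ proper C g
      proper-contract = T-⇔⇒≡ (mk⇔ (from (T-proper C g) ∘ fwd ∘ to (T-proper D f))
                                    (from (T-proper D f) ∘ bwd ∘ to (T-proper C g)))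
        where
        fwd : Proper D f → Proper C g
        fwd pD {a} {b} adj = linked (to (T-Adj-contract G u v) adj)
          where
          at-merged : ∀ {a b} → a ≢ b → punchIn v a ≡ u → T (Adj G v (punchIn v b)) → g a ≢ g b
          at-merged {a} {b} a≢b a↦u adj′ ga≡gb =
            pD (from (T-Adj-delete G u v) (adj′ , λ
                 { (inj₁ (v≡u , _)) → v≢u v≡u
                 ; (inj₂ (_ , b↦u)) → a≢b (punchIn-injective v a b (trans a↦u (sym b↦u))) }))
               (begin f v              ≡⟨ f-v ⟩
                      g u′             ≡⟨ cong g (punchIn-injective v u′ a (trans u′↦u (sym a↦u))) ⟩
                      g a              ≡⟨ ga≡gb ⟩
                      g b              ≡⟨ f∘punchIn b ⟨
                      f (punchIn v b)  ∎)
          linked : a ≢ b × Linked G u v a b → g a ≢ g b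
          linked (a≢b , inj₁ adj′) ga≡gb =
            pD (from (T-Adj-delete G u v) (adj′ , λ
                 { (inj₁ (_ , b↦v)) → punchInᵢ≢i v b b↦v
                 ; (inj₂ (a↦v , _)) → punchInᵢ≢i v a a↦v }))
               (trans (f∘punchIn a) (trans ga≡gb (sym (f∘punchIn b))))
          linked (a≢b , inj₂ (inj₁ (a↦u , adj′))) = at-merged a≢b a↦u adj′
          linked (a≢b , inj₂ (inj₂ (b↦u , adj′))) =
            at-merged (a≢b ∘ sym) b↦u (subst T (Adj-sym G _ v) adj′) ∘ sym

        bwd : Proper C g → Proper D f
        bwd pC {p} {q} adj = separated (punchInView v p) (punchInView v q) adj
          where
          at-v : ∀ b → T (Adj D v (punchIn v b)) → f v ≢ f (punchIn v b)
          at-v b adj fv≡fb = pC (from (T-Adj-contract G u v) (u′≢b , inj₂ (inj₁ (u′↦u , adjG))))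
                                (trans (sym f-v) (trans fv≡fb (f∘punchIn b)))
            where
            adjG = proj₁ (to (T-Adj-delete G u v) adj)
            u′≢b : u′ ≢ b
            u′≢b refl = proj₂ (to (T-Adj-delete G u v) adj) (inj₂ (refl , u′↦u))
          separated : ∀ {p q} → PunchInView v p → PunchInView v q → T (Adj D p q) → f p ≢ f q
          separated at            at            adj = ⊥-elim (Adj⇒≢ D {v} adj refl)
          separated at            (punchedIn b) adj = at-v b adj
          separated (punchedIn a) at            adj = at-v a (subst T (Adj-sym D _ v) adj) ∘ sym
          separated (punchedIn a) (punchedIn b) adj fa≡fb =
            pC (from (T-Adj-contract G u v) (Adj⇒≢ G adjG ∘ cong (punchIn v) , inj₁ adjG))
               (trans (sym (f∘punchIn a)) (trans fa≡fb (f∘punchIn b)))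
            where adjG = proj₁ (to (T-Adj-delete G u v) adj)

  chrom≡sumColourings : ∀ {n} (H : Graph n) x → chrom H x ≡ sumColourings x n (𝟙 ∘ proper H)
  chrom≡sumColourings {n} H x = length-filter≡sumOver (proper H) (allColourings n x)

  module _ {m : ℕ} (G : Graph (suc m)) {u v : Fin (suc m)} (uv : T (Adj G u v)) (x : ℕ) where

    private
      D = delete G u v
      C = contract G u v
      u′ = punchOut (Adj⇒≢ G uv ∘ sym)
      u′↦u : punchIn v u′ ≡ u
      u′↦u = punchIn-punchOut (Adj⇒≢ G uv ∘ sym)

    proper-delete-insertAt : ∀ (g : Fin m → Fin x) c →
      proper D (insertAt g v c) ∧ (insertAt g v c u == insertAt g v c v) ≡ proper C g ∧ (g u′ == c)
    proper-delete-insertAt g c =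
      trans (cong (proper D (insertAt g v c) ∧_) (cong₂ _==_ at-u (insertAt-lookup g v c))) (identify-at-u′)
      where
      at-u : insertAt g v c u ≡ g u′
      at-u = trans (cong (insertAt g v c) (sym u′↦u)) (insertAt-punchIn g v c u′)
      identify-at-u′ : proper D (insertAt g v c) ∧ (g u′ == c) ≡ proper C g ∧ (g u′ == c)
      identify-at-u′ with g u′ ≟ c
      ... | yes refl = cong (_∧ true) (proper-contract G uv u′↦u g)
      ... | no _     = trans (∧-zeroʳ _) (sym (∧-zeroʳ _))

    chrom-delete : chrom D x ≡ chrom G x + chrom C x
    chrom-delete = begin
      chrom D x
        ≡⟨ chrom≡sumColourings D x ⟩
      sumColourings x (suc m) (λ f → 𝟙 (proper D f))
        ≡⟨ sumOver-cong (allColourings (suc m) x) (λ f → 𝟙-split (proper D f) (f u == f v)) ⟩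
      sumColourings x (suc m) (λ f → 𝟙 (proper D f ∧ not (f u == f v)) + 𝟙 (proper D f ∧ (f u == f v)))
        ≡⟨ sumOver-+ (allColourings (suc m) x) _ _ ⟩
      sumColourings x (suc m) (λ f → 𝟙 (proper D f ∧ not (f u == f v)))
        + sumColourings x (suc m) (λ f → 𝟙 (proper D f ∧ (f u == f v)))
        ≡⟨ cong₂ _+_ G-term merged-term ⟩
      chrom G x + sumOver (allFin x) (λ c → sumColourings x m (λ g → 𝟙 (proper C g ∧ (g u′ == c))))
        ≡⟨ cong (chrom G x +_) (sumOver-comm (allFin x) (allColourings m x) _) ⟩
      chrom G x + sumColourings x m (λ g → sumOver (allFin x) (λ c → 𝟙 (proper C g ∧ (g u′ == c))))
        ≡⟨ cong (chrom G x +_) (sumOver-cong (allColourings m x) λ g →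
             sumOver-allFin-𝟙-∧-== (proper C g) (g u′)) ⟩
      chrom G x + sumColourings x m (𝟙 ∘ proper C)
        ≡⟨ cong (chrom G x +_) (chrom≡sumColourings C x) ⟨
      chrom G x + chrom C x
        ∎
      where
      G-term : sumColourings x (suc m) (λ f → 𝟙 (proper D f ∧ not (f u == f v))) ≡ chrom G x
      G-term = trans (sumOver-cong (allColourings (suc m) x) (λ f → cong 𝟙 (sym (proper-delete G uv f))))
                     (sym (chrom≡sumColourings G x))
      merged-term : sumColourings x (suc m) (λ f → 𝟙 (proper D f ∧ (f u == f v)))
                  ≡ sumOver (allFin x) (λ c → sumColourings x m (λ g → 𝟙 (proper C g ∧ (g u′ == c))))
      merged-term =
        trans (sumColourings-insertAt x m v _
                (λ f≗g → cong 𝟙 (cong₂ _∧_ (proper-cong D f≗g) (cong₂ _==_ (f≗g u) (f≗g v)))))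
              (sumOver-cong (allFin x) λ c → sumOver-cong (allColourings m x) λ g →
                cong 𝟙 (proper-delete-insertAt g c))

module RisingFactorialBasis where

  open import Defs
  open import Data.Empty using (⊥-elim)
  open import Data.Nat as ℕ using (ℕ; zero; suc; _∸_; _≤_; _<_; z≤n; s≤s)
  import Data.Nat.Properties as ℕ
  import Data.Nat.Tactic.RingSolver as ℕ-Ring
  open import Data.Integer using (ℤ; +_; -_; _+_; _-_; _*_; 0ℤ; ∣_∣)
  open import Data.Integer.Properties
    using (+-assoc; +-identityˡ; +-identityʳ; +-inverseʳ; *-identityʳ; *-zeroʳ; neg-distrib-+;
           pos-+; pos-*; ∣-i∣≡∣i∣; i*j≡0⇒i≡0∨j≡0; i-j≡0⇒i≡j; +-commutativeSemigroup)
  open import Data.Integer.Tactic.RingSolver using (solve-∀)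
  open import Algebra.Properties.CommutativeSemigroup +-commutativeSemigroup using (interchange)
  open import Data.List using (map; foldr; applyUpTo)
  open import Data.Sum using (inj₁; inj₂)
  open import Function using (_∘_; id)
  open import Relation.Binary.PropositionalEquality
  open ≡-Reasoning

  sumBelow : ℕ → (ℕ → ℤ) → ℤ
  sumBelow zero    f = 0ℤ
  sumBelow (suc N) f = f 0 + sumBelow N (f ∘ suc)

  sumBelow-cong : ∀ N {f g : ℕ → ℤ} → (∀ i → i < N → f i ≡ g i) → sumBelow N f ≡ sumBelow N g
  sumBelow-cong zero    f≗g = refl
  sumBelow-cong (suc N) f≗g = cong₂ _+_ (f≗g 0 (s≤s z≤n)) (sumBelow-cong N (λ i → f≗g (suc i) ∘ s≤s))

  sumBelow-zero : ∀ N (f : ℕ → ℤ) → (∀ i → i < N → f i ≡ 0ℤ) → sumBelow N f ≡ 0ℤ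
  sumBelow-zero zero    f f≗0 = refl
  sumBelow-zero (suc N) f f≗0 rewrite f≗0 0 (s≤s z≤n) =
    trans (+-identityˡ _) (sumBelow-zero N (f ∘ suc) (λ i → f≗0 (suc i) ∘ s≤s))

  sumBelow-+ : ∀ N (f g : ℕ → ℤ) → sumBelow N (λ i → f i + g i) ≡ sumBelow N f + sumBelow N g
  sumBelow-+ zero    f g = refl
  sumBelow-+ (suc N) f g rewrite sumBelow-+ N (f ∘ suc) (g ∘ suc) = interchange (f 0) (g 0) _ _

  sumBelow-neg : ∀ N (f : ℕ → ℤ) → sumBelow N (λ i → - f i) ≡ - sumBelow N f
  sumBelow-neg zero    f = refl
  sumBelow-neg (suc N) f rewrite sumBelow-neg N (f ∘ suc) = sym (neg-distrib-+ (f 0) _)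

  sumBelow-last : ∀ N (f : ℕ → ℤ) → sumBelow (suc N) f ≡ sumBelow N f + f N
  sumBelow-last zero    f = trans (+-identityʳ (f 0)) (sym (+-identityˡ (f 0)))
  sumBelow-last (suc N) f rewrite sumBelow-last N (f ∘ suc) = sym (+-assoc (f 0) _ _)

  foldr-+-applyUpTo : ∀ N (g : ℕ → ℤ) (f : ℕ → ℕ) →
                      foldr _+_ 0ℤ (map g (applyUpTo f N)) ≡ sumBelow N (g ∘ f)
  foldr-+-applyUpTo zero    g f = refl
  foldr-+-applyUpTo (suc N) g f = cong (_+_ (g (f 0))) (foldr-+-applyUpTo N g (f ∘ suc))

  rising-unfoldˡ : ∀ y j → rising y (suc j) ≡ y ℕ.* rising (suc y) j
  rising-unfoldˡ y zero    = trans (ℕ.+-identityʳ (y ℕ.+ 0)) (trans (ℕ.+-identityʳ y) (sym (ℕ.*-identityʳ y)))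
  rising-unfoldˡ y (suc j) rewrite rising-unfoldˡ y j | ℕ.+-suc y j =
    ℕ.*-assoc y (rising (suc y) j) (suc (y ℕ.+ j))

  rising-difference : ∀ y j → rising (suc y) (suc j) ≡ rising y (suc j) ℕ.+ suc j ℕ.* rising (suc y) j
  rising-difference y j rewrite rising-unfoldˡ y j = split (rising (suc y) j) y j
    where split : ∀ r y j → r ℕ.* suc (y ℕ.+ j) ≡ y ℕ.* r ℕ.+ suc j ℕ.* r
          split = ℕ-Ring.solve-∀

  risingCombination : ℕ → (ℕ → ℤ) → ℕ → ℤ
  risingCombination N e y = sumBelow N (λ i → e i * + rising y i)

  Δcoefficients : (ℕ → ℤ) → ℕ → ℤ
  Δcoefficients e j = + suc j * e (suc j)

  risingCombination-difference : ∀ N (e : ℕ → ℤ) y →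
    risingCombination (suc N) e (suc y)
      ≡ risingCombination (suc N) e y + risingCombination N (Δcoefficients e) (suc y)
  risingCombination-difference N e y = begin
    e 0 * + 1 + sumBelow N (λ j → e (suc j) * + rising (suc y) (suc j))
      ≡⟨ cong (_+_ (e 0 * + 1)) (sumBelow-cong N (λ j _ → term j)) ⟩
    e 0 * + 1 + sumBelow N (λ j → old j + new j)
      ≡⟨ cong (_+_ (e 0 * + 1)) (sumBelow-+ N old new) ⟩
    e 0 * + 1 + (sumBelow N old + sumBelow N new)
      ≡⟨ +-assoc (e 0 * + 1) _ _ ⟨
    e 0 * + 1 + sumBelow N old + sumBelow N new
      ∎
    where
    old new : ℕ → ℤ
    old j = e (suc j) * + rising y (suc j)
    new j = Δcoefficients e j * + rising (suc y) j
    distribute : ∀ a r k q → a * (r + k * q) ≡ a * r + k * a * q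
    distribute = solve-∀
    term : ∀ j → e (suc j) * + rising (suc y) (suc j) ≡ old j + new j
    term j = begin
      e (suc j) * + rising (suc y) (suc j)
        ≡⟨ cong (λ n → e (suc j) * + n) (rising-difference y j) ⟩
      e (suc j) * + (rising y (suc j) ℕ.+ suc j ℕ.* rising (suc y) j)
        ≡⟨ cong (e (suc j) *_) (trans (pos-+ (rising y (suc j)) _)
                                      (cong (_+_ (+ rising y (suc j))) (pos-* (suc j) (rising (suc y) j)))) ⟩
      e (suc j) * (+ rising y (suc j) + + suc j * + rising (suc y) j)
        ≡⟨ distribute (e (suc j)) (+ rising y (suc j)) (+ suc j) (+ rising (suc y) j) ⟩
      old j + new j
        ∎

  -- Forward differences lower the degree: by risingCombination-difference, the difference of a
  -- combination of degree < N+1 is one of degree < N with coefficients (j+1)·e_{j+1}, vanishing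
  -- one step further out; the coefficient e₀ is then what remains at any point of vanishing.
  risingCombination≡0⇒coefficients≡0 : ∀ N s (e : ℕ → ℤ) →
                                       (∀ y → s ≤ y → risingCombination N e y ≡ 0ℤ) →
                                       ∀ i → i < N → e i ≡ 0ℤ
  risingCombination≡0⇒coefficients≡0 (suc N) s e vanishes = coefficient
    where
    Δe : ℕ → ℤ
    Δe = Δcoefficients e
    difference-vanishes : ∀ y → suc s ≤ y → risingCombination N Δe y ≡ 0ℤ
    difference-vanishes (suc y) (s≤s s≤y) = begin
      risingCombination N Δe (suc y)
        ≡⟨ +-identityˡ _ ⟨
      0ℤ + risingCombination N Δe (suc y)
        ≡⟨ cong (λ a → a + risingCombination N Δe (suc y)) (vanishes y s≤y) ⟨
      risingCombination (suc N) e y + risingCombination N Δe (suc y)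
        ≡⟨ risingCombination-difference N e y ⟨
      risingCombination (suc N) e (suc y)
        ≡⟨ vanishes (suc y) (ℕ.m≤n⇒m≤1+n s≤y) ⟩
      0ℤ
        ∎
    later : ∀ j → j < N → e (suc j) ≡ 0ℤ
    later j j<N with i*j≡0⇒i≡0∨j≡0 (+ suc j)
                       (risingCombination≡0⇒coefficients≡0 N (suc s) Δe difference-vanishes j j<N)
    ... | inj₂ e≡0 = e≡0
    first : e 0 ≡ 0ℤ
    first = begin
      e 0                               ≡⟨ *-identityʳ (e 0) ⟨
      e 0 * + 1                         ≡⟨ +-identityʳ _ ⟨
      e 0 * + 1 + 0ℤ                    ≡⟨ cong (_+_ (e 0 * + 1)) (sumBelow-zero N _ λ j j<N →
                                             cong (λ a → a * + rising s (suc j)) (later j j<N)) ⟨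
      risingCombination (suc N) e s     ≡⟨ vanishes s ℕ.≤-refl ⟩
      0ℤ                                ∎
    coefficient : ∀ i → i < suc N → e i ≡ 0ℤ
    coefficient zero    _         = first
    coefficient (suc j) (s≤s j<N) = later j j<N

  ∣sgn∣≡1 : ∀ k → ∣ sgn k ∣ ≡ 1
  ∣sgn∣≡1 zero    = refl
  ∣sgn∣≡1 (suc k) = trans (∣-i∣≡∣i∣ (sgn k)) (∣sgn∣≡1 k)

  sgn≢0 : ∀ k → sgn k ≢ 0ℤ
  sgn≢0 k sgn≡0 with () ← trans (sym (∣sgn∣≡1 k)) (cong ∣_∣ sgn≡0)

  signed : ℕ → (ℕ → ℤ) → ℕ → ℤ
  signed n c i = sgn (n ∸ i) * c i

  risingSum≡risingCombination : ∀ n c x → risingSum n c x ≡ risingCombination (suc n) (signed n c) x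
  risingSum≡risingCombination n c x = foldr-+-applyUpTo (suc n) (λ i → signed n c i * + rising x i) id

  risingSum≡0⇒coefficients≡0 : ∀ n (c : ℕ → ℤ) → (∀ x → risingSum n c x ≡ 0ℤ) → ∀ i → i ≤ n → c i ≡ 0ℤ
  risingSum≡0⇒coefficients≡0 n c vanishes i i≤n
    with i*j≡0⇒i≡0∨j≡0 (sgn (n ∸ i))
           (risingCombination≡0⇒coefficients≡0 (suc n) 0 (signed n c)
              (λ x _ → trans (sym (risingSum≡risingCombination n c x)) (vanishes x)) i (s≤s i≤n))
  ... | inj₁ sgn≡0 = ⊥-elim (sgn≢0 (n ∸ i) sgn≡0)
  ... | inj₂ c≡0   = c≡0

  module _ (n : ℕ) (x : ℕ) where

    private
      term : (ℕ → ℤ) → ℕ → ℤ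
      term c i = signed n c i * + rising x i

      expand : ∀ c → risingSum n c x ≡ sumBelow (suc n) (term c)
      expand c = risingSum≡risingCombination n c x

    risingSum-+ : ∀ c d → risingSum n (λ i → c i + d i) x ≡ risingSum n c x + risingSum n d x
    risingSum-+ c d = begin
      risingSum n (λ i → c i + d i) x
        ≡⟨ expand _ ⟩
      sumBelow (suc n) (term (λ i → c i + d i))
        ≡⟨ sumBelow-cong (suc n) (λ i _ → distribute (sgn (n ∸ i)) (c i) (d i) (+ rising x i)) ⟩
      sumBelow (suc n) (λ i → term c i + term d i)
        ≡⟨ sumBelow-+ (suc n) (term c) (term d) ⟩
      sumBelow (suc n) (term c) + sumBelow (suc n) (term d)
        ≡⟨ cong₂ _+_ (expand c) (expand d) ⟨
      risingSum n c x + risingSum n d x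
        ∎
      where distribute : ∀ s a b r → s * (a + b) * r ≡ s * a * r + s * b * r
            distribute = solve-∀

    risingSum-neg : ∀ c → risingSum n (λ i → - c i) x ≡ - risingSum n c x
    risingSum-neg c = begin
      risingSum n (λ i → - c i) x
        ≡⟨ expand _ ⟩
      sumBelow (suc n) (term (λ i → - c i))
        ≡⟨ sumBelow-cong (suc n) (λ i _ → neg-inside (sgn (n ∸ i)) (c i) (+ rising x i)) ⟩
      sumBelow (suc n) (λ i → - term c i)
        ≡⟨ sumBelow-neg (suc n) (term c) ⟩
      - sumBelow (suc n) (term c)
        ≡⟨ cong -_ (expand c) ⟨
      - risingSum n c x
        ∎
      where neg-inside : ∀ s a r → s * (- a) * r ≡ - (s * a * r)
            neg-inside = solve-∀

    risingSum-suc : ∀ c → c (suc n) ≡ 0ℤ → risingSum (suc n) c x ≡ - risingSum n c x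
    risingSum-suc c top≡0 = begin
      risingSum (suc n) c x                       ≡⟨ risingSum≡risingCombination (suc n) c x ⟩
      sumBelow (suc (suc n)) term′                ≡⟨ sumBelow-last (suc n) term′ ⟩
      sumBelow (suc n) term′ + term′ (suc n)      ≡⟨ cong₂ _+_ (sumBelow-cong (suc n) lower) top ⟩
      sumBelow (suc n) (λ i → - term c i) + 0ℤ    ≡⟨ +-identityʳ _ ⟩
      sumBelow (suc n) (λ i → - term c i)         ≡⟨ sumBelow-neg (suc n) (term c) ⟩
      - sumBelow (suc n) (term c)                 ≡⟨ cong -_ (expand c) ⟨
      - risingSum n c x                           ∎
      where
      term′ : ℕ → ℤ
      term′ i = signed (suc n) c i * + rising x i
      neg-outside : ∀ s a r → - s * a * r ≡ - (s * a * r)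
      neg-outside = solve-∀
      lower : ∀ i → i < suc n → term′ i ≡ - term c i
      lower i (s≤s i≤n) rewrite ℕ.+-∸-assoc 1 i≤n = neg-outside (sgn (n ∸ i)) (c i) (+ rising x i)
      top : term′ (suc n) ≡ 0ℤ
      top rewrite top≡0 = cong (_* + rising x (suc n)) (*-zeroʳ (sgn (n ∸ n)))

  risingSum-injective : ∀ n (c d : ℕ → ℤ) → (∀ x → risingSum n c x ≡ risingSum n d x) →
                        ∀ i → i ≤ n → c i ≡ d i
  risingSum-injective n c d agree i i≤n =
    i-j≡0⇒i≡j (c i) (d i) (risingSum≡0⇒coefficients≡0 n (λ i → c i - d i) difference-vanishes i i≤n)
    where
    difference-vanishes : ∀ x → risingSum n (λ i → c i - d i) x ≡ 0ℤ
    difference-vanishes x = begin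
      risingSum n (λ i → c i - d i) x             ≡⟨ risingSum-+ n x c (λ i → - d i) ⟩
      risingSum n c x + risingSum n (-_ ∘ d) x    ≡⟨ cong₂ _+_ (agree x) (risingSum-neg n x d) ⟩
      risingSum n d x - risingSum n d x           ≡⟨ +-inverseʳ (risingSum n d x) ⟩
      0ℤ                                          ∎

open import Defs
open import Data.Bool using (true)
open import Data.Bool.Properties using (T-≡)
open import Data.Nat as ℕ using (ℕ; suc; _≤?_)
open import Data.Nat.Properties using (n<1+n; <-trans; ≰⇒>)
open import Data.Fin using (Fin)
open import Data.Integer using (ℤ; +_; _+_; _-_)
open import Data.Integer.Properties using (pos-+)
open import Data.Integer.Tactic.RingSolver using (solve-∀)
open import Data.Product using (_,_)
open import Function using (Equivalence)
open import Relation.Nullary using (yes; no)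
open import Relation.Binary.PropositionalEquality using (_≡_; sym; trans; cong; cong₂; module ≡-Reasoning)
open DeletionContraction using (chrom-delete)
open RisingFactorialBasis using (risingSum-+; risingSum-suc; risingSum-injective)

mainTheorem12 : ∀ {m} (G : Graph (suc m)) (u v : Fin (suc m)) → Adj G u v ≡ true →
    (cG cD cC : ℕ → ℤ) → IsCoeffs G cG → IsCoeffs (delete G u v) cD → IsCoeffs (contract G u v) cC →
    ∀ i → cG i ≡ cD i + cC i
mainTheorem12 {m} G u v uv cG cD cC (cG-top , χG) (cD-top , χD) (cC-top , χC) i with i ≤? suc m
... | yes i≤1+m = risingSum-injective (suc m) cG (λ i → cD i + cC i) expansions-agree i i≤1+m
  where
  open ≡-Reasoning
  C = contract G u v
  cancel : ∀ a b → a ≡ a + b - b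
  cancel = solve-∀
  expansions-agree : ∀ x → risingSum (suc m) cG x ≡ risingSum (suc m) (λ i → cD i + cC i) x
  expansions-agree x = begin
    risingSum (suc m) cG x
      ≡⟨ χG x ⟨
    + chrom G x
      ≡⟨ cancel (+ chrom G x) (+ chrom C x) ⟩
    + chrom G x + + chrom C x - + chrom C x
      ≡⟨ cong (_- + chrom C x) (pos-+ (chrom G x) (chrom C x)) ⟨
    + (chrom G x ℕ.+ chrom C x) - + chrom C x
      ≡⟨ cong₂ (λ d c → + d - c) (sym (chrom-delete G (Equivalence.from T-≡ uv) x)) (χC x) ⟩
    + chrom (delete G u v) x - risingSum m cC x
      ≡⟨ cong₂ _+_ (sym (χD x)) (risingSum-suc m x cC (cC-top (suc m) (n<1+n m))) ⟨
    risingSum (suc m) cD x + risingSum (suc m) cC x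
      ≡⟨ risingSum-+ (suc m) x cD cC ⟨
    risingSum (suc m) (λ i → cD i + cC i) x
      ∎
... | no i≰1+m =
  trans (cG-top i 1+m<i) (sym (cong₂ _+_ (cD-top i 1+m<i) (cC-top i (<-trans (n<1+n m) 1+m<i))))
  where 1+m<i = ≰⇒> i≰1+m
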